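{- Let $p<q$ be prime numbers and $N=pq$. If $(\mathbb{Q}\setminus\mathbb{Z})\text{ - }\mathcal{KS}(N)=\emptyset$, then $\mathbb{Z}\text{ - }\mathcal{KS}(N)=\{q+p-1\}$.
   Context: For a rational number $\alpha\neq 0$ write $\alpha=\frac{\alpha_1}{\alpha_2}$ with $\alpha_1,\alpha_2$ integers and $\gcd(\alpha_1,\alpha_2)=1$. An integer $N\ge 2$ is called an $\alpha$-Korselt number if $N\neq\alpha$ and $\alpha_2 r-\alpha_1$ divides $\alpha_2 N-\alpha_1$ (in $\mathbb{Z}$; $0$ divides only $0$) for every prime divisor $r$ of $N$. For a subset $\mathbb{A}\subseteq\mathbb{Q}$, $\mathbb{A}\text{ - }\mathcal{KS}(N)$ denotes the set of all $\beta\in\mathbb{A}\setminus\{0,N\}$ such that $N$ is a $\beta$-Korselt number (such $\beta$ are called $N$-Korselt bases). -}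

module Defs where

open import Data.Nat as ℕ using (ℕ; _≤_)
open import Data.Nat.Divisibility as ℕD using ()
open import Data.Nat.Primality using (Prime)
open import Data.Integer as ℤ using (ℤ; +_)
open import Data.Integer.Divisibility as ℤD using ()
open import Data.Rational using (ℚ; 0ℚ; _/_; ↥_; ↧_; ↧ₙ_)
open import Data.Product using (_×_)
open import Relation.Binary.PropositionalEquality using (_≡_; _≢_)
open import Relation.Nullary using (¬_)

ℕ→ℚ : ℕ → ℚ
ℕ→ℚ n = (+ n) / 1

-- α = α₁/α₂ in lowest terms: α₁ = ↥ α, α₂ = ↧ α (> 0).
-- N is an α-Korselt number.
IsKorselt : ℚ → ℕ → Set
IsKorselt α N =
  2 ≤ N × α ≢ ℕ→ℚ N ×
  (∀ (r : ℕ) → Prime r → r ℕD.∣ N →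
     ((↧ α) ℤ.* (+ r) ℤ.- (↥ α)) ℤD.∣ ((↧ α) ℤ.* (+ N) ℤ.- (↥ α)))

IsInteger : ℚ → Set
IsInteger β = ↧ₙ β ≡ 1

NonInteger : ℚ → Set
NonInteger β = ¬ IsInteger β

InKS : (ℚ → Set) → ℕ → ℚ → Set
InKS A N β = A β × β ≢ 0ℚ × β ≢ ℕ→ℚ N × IsKorselt β N

-- Let p < q be primes, N = pq and φ = (p - 1)(q - 1).  An integer B is an N-Korselt
-- base iff (p - B) ∣ p(q - 1) and (q - B) ∣ q(p - 1).  The base p + q - 1 always
-- qualifies, since N - (p + q - 1) = φ.  Conversely, let B ∉ {0, N, p + q - 1} be one.
--   1. q ∤ B: writing B = tq, the two conditions force t ∈ {0, p}.
--   2. Hence q - B ∣ p - 1, and s = p + q - 1 - B satisfies 0 < s ≤ 2(p - 1).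
--   3. φ + s does not divide N·s, by comparing sizes of the divisors of p·φ.
--   4. α = N·s/(φ + s) satisfies the Korselt conditions, since (φ + s)·r - N·s equals
--      -r(r' - 1)·(r' - B) for {r, r'} = {p, q}, and (φ + s)·N - N·s = N·φ.
--   5. By 3, α is a non-integral Korselt base, which the hypothesis excludes.
module Submission where

open import Defs
open import Data.Nat using (ℕ; _<_; _*_; _+_; _∸_)
open import Data.Nat.Primality using (Prime)
open import Data.Rational using (ℚ)
open import Function.Bundles using (_⇔_)
open import Relation.Binary.PropositionalEquality using (_≡_)
open import Relation.Nullary using (¬_)

open import Data.Nat as ℕ using (zero; suc; NonZero)
import Data.Nat.Properties as ℕP
import Data.Nat.Divisibility as ℕD
import Data.Nat.Coprimality as ℕC
open import Data.Nat.Primality using (¬prime[0]; ¬prime[1]; prime⇒irreducible; prime⇒nonTrivial; euclidsLemma)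
open import Data.Integer as ℤ using (ℤ; +_; -[1+_]; 0ℤ; 1ℤ)
import Data.Integer.Properties as ℤP
import Data.Integer.Divisibility as ℤD
import Data.Integer.Divisibility.Signed as ℤS
import Data.Integer.Coprimality as ℤC
import Data.Integer.GCD as ℤG
open import Data.Integer.Tactic.RingSolver using (solve-∀)
import Data.Nat.Tactic.RingSolver as ℕSolver
open import Data.Rational using (mkℚ; 0ℚ; _/_; ↥_; ↧_; ↧ₙ_)
import Data.Rational.Properties as ℚP
open import Data.Product using (_×_; _,_; Σ; uncurry)
open import Data.Sum using (_⊎_; inj₁; inj₂; [_,_])
open import Data.Empty using (⊥; ⊥-elim)
open import Relation.Nullary using (Dec; yes; no)
open import Relation.Binary.PropositionalEquality using (refl; sym; trans; cong; cong₂; subst; subst₂; _≢_; module ≡-Reasoning)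
open import Function.Bundles using (mk⇔)
open import Function.Base using (_∘_)

↥[i/1] : ∀ i → ↥ (i / 1) ≡ i
↥[i/1] i = trans (sym (ℤP.*-identityʳ _)) (trans (cong (↥ (i / 1) ℤ.*_) (sym (ℤG.gcd-zeroʳ i))) (ℚP.↥-/ i 1))

↧[i/1] : ∀ i → ↧ (i / 1) ≡ 1ℤ
↧[i/1] i = trans (sym (ℤP.*-identityʳ _)) (trans (cong (↧ (i / 1) ℤ.*_) (sym (ℤG.gcd-zeroʳ i))) (ℚP.↧-/ i 1))

ℕ→ℚ-injective : ∀ {m n} → ℕ→ℚ m ≡ ℕ→ℚ n → m ≡ n
ℕ→ℚ-injective {m} {n} eq = ℤP.+-injective (trans (sym (↥[i/1] (+ m))) (trans (cong ↥_ eq) (↥[i/1] (+ n))))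

ℚ-ext : ∀ {x y : ℚ} → ↥ x ≡ ↥ y → ↧ₙ x ≡ ↧ₙ y → x ≡ y
ℚ-ext {mkℚ _ _ _} {mkℚ _ _ _} refl refl = refl

integral⇒≡ : ∀ {β} i → IsInteger β → ↥ β ≡ i → β ≡ i / 1
integral⇒≡ i β-int ↥β≡i = ℚ-ext (trans ↥β≡i (sym (↥[i/1] i))) (trans β-int (sym (ℤP.+-injective (↧[i/1] i))))

nonInteger⇒≢ℕ : ∀ {α} n → NonInteger α → α ≢ ℕ→ℚ n
nonInteger⇒≢ℕ n α-nonint α≡n = α-nonint (subst IsInteger (sym α≡n) (ℤP.+-injective (↧[i/1] (+ n))))

/-≢0 : ∀ A X .{{_ : NonZero X}} → A ≢ 0ℤ → A / X ≢ 0ℚ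
/-≢0 A X A≢0 A/X≡0 = A≢0 (begin
  A                                  ≡⟨ sym (ℚP.↥-/ A X) ⟩
  ↥ (A / X) ℤ.* ℤG.gcd A (+ X)       ≡⟨ cong (ℤ._* ℤG.gcd A (+ X)) (ℚP.p≡0⇒↥p≡0 (A / X) A/X≡0) ⟩
  0ℤ ℤ.* ℤG.gcd A (+ X)              ≡⟨ ℤP.*-zeroˡ (ℤG.gcd A (+ X)) ⟩
  0ℤ                                 ∎)
  where open ≡-Reasoning

KorseltAt : ℚ → ℕ → ℕ → Set
KorseltAt α N r = ((↧ α) ℤ.* (+ r) ℤ.- (↥ α)) ℤD.∣ ((↧ α) ℤ.* (+ N) ℤ.- (↥ α))

-- For α = A/X the condition may be checked on the unreduced pair (A, X):
-- both sides only lose the common factor gcd(A, X) when the fraction is reduced.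
korselt-/ : ∀ A X .{{_ : NonZero X}} N r →
            ((+ X) ℤ.* (+ r) ℤ.- A) ℤS.∣ ((+ X) ℤ.* (+ N) ℤ.- A) → KorseltAt (A / X) N r
korselt-/ A X N r X-div =
  ℤS.∣⇒∣ᵤ (ℤS.*-cancelʳ-∣ g {reduced r} {reduced N} {{ℤ.≢-nonZero g≢0}} (subst₂ ℤS._∣_ (unreduce r) (unreduce N) X-div))
  where
  reduced : ℕ → ℤ
  reduced m = (↧ (A / X)) ℤ.* (+ m) ℤ.- (↥ (A / X))
  g : ℤ
  g = ℤG.gcd A (+ X)
  g≢0 : g ≢ 0ℤ
  g≢0 g≡0 = ℕ.≢-nonZero⁻¹ X (ℤP.+-injective (ℤG.gcd[i,j]≡0⇒j≡0 {A} g≡0))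
  pull-out : ∀ d n g m → d ℤ.* g ℤ.* m ℤ.- n ℤ.* g ≡ (d ℤ.* m ℤ.- n) ℤ.* g
  pull-out = solve-∀
  unreduce : ∀ m → (+ X) ℤ.* (+ m) ℤ.- A ≡ reduced m ℤ.* g
  unreduce m = trans (cong₂ (λ x a → x ℤ.* (+ m) ℤ.- a) (sym (ℚP.↧-/ A X)) (sym (ℚP.↥-/ A X)))
                     (pull-out (↧ (A / X)) (↥ (A / X)) g (+ m))

integral-/ : ∀ A X .{{_ : NonZero X}} → IsInteger (A / X) → (+ X) ℤS.∣ A
integral-/ A X int = ℤS.divides (↥ (A / X)) (begin
  A                   ≡⟨ sym (ℚP.↥-/ A X) ⟩
  ↥ (A / X) ℤ.* g     ≡⟨ cong (↥ (A / X) ℤ.*_) g≡X ⟩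
  ↥ (A / X) ℤ.* + X   ∎)
  where
  open ≡-Reasoning
  g : ℤ
  g = ℤG.gcd A (+ X)
  g≡X : g ≡ + X
  g≡X = begin
    g                  ≡⟨ sym (ℤP.*-identityˡ g) ⟩
    1ℤ ℤ.* g           ≡⟨ cong (λ d → + d ℤ.* g) (sym int) ⟩
    ↧ (A / X) ℤ.* g    ≡⟨ ℚP.↧-/ A X ⟩
    + X                ∎

integral-korselt : ∀ β N r → IsInteger β → KorseltAt β N r → (+ r ℤ.- ↥ β) ℤS.∣ (+ N ℤ.- ↥ β)
integral-korselt β N r β-int korselt = subst₂ ℤS._∣_ (unit-denominator r) (unit-denominator N) (ℤS.∣ᵤ⇒∣ korselt)
  where
  unit-denominator : ∀ m → ↧ β ℤ.* + m ℤ.- ↥ β ≡ + m ℤ.- ↥ β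
  unit-denominator m = cong (ℤ._- ↥ β) (trans (cong (λ d → + d ℤ.* + m) β-int) (ℤP.*-identityˡ (+ m)))

korselt-/1 : ∀ i N r → (+ r ℤ.- i) ℤS.∣ (+ N ℤ.- i) → KorseltAt (i / 1) N r
korselt-/1 i N r i-div = ℤS.∣⇒∣ᵤ (subst₂ ℤS._∣_ (sym (unit-denominator r)) (sym (unit-denominator N)) i-div)
  where
  unit-denominator : ∀ m → ↧ (i / 1) ℤ.* + m ℤ.- ↥ (i / 1) ≡ + m ℤ.- i
  unit-denominator m = trans (cong₂ (λ d n → d ℤ.* + m ℤ.- n) (↧[i/1] i) (↥[i/1] i))
                             (cong (ℤ._- i) (ℤP.*-identityˡ (+ m)))

prime∤⇒coprime : ∀ {p n} → Prime p → ¬ (p ℕD.∣ n) → ℕC.Coprime p n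
prime∤⇒coprime p-prime p∤n (d∣p , d∣n) with prime⇒irreducible p-prime d∣p
... | inj₁ d≡1 = d≡1
... | inj₂ refl = ⊥-elim (p∤n d∣n)

prime∣prime⇒≡ : ∀ {r p} → Prime r → Prime p → r ℕD.∣ p → r ≡ p
prime∣prime⇒≡ r-prime p-prime r∣p with prime⇒irreducible p-prime r∣p
... | inj₁ refl = ⊥-elim (¬prime[1] r-prime)
... | inj₂ r≡p = r≡p

prime∣pq : ∀ {r p q} → Prime r → Prime p → Prime q → r ℕD.∣ p * q → r ≡ p ⊎ r ≡ q
prime∣pq {p = p} {q} r-prime p-prime q-prime r∣pq with euclidsLemma p q r-prime r∣pq
... | inj₁ r∣p = inj₁ (prime∣prime⇒≡ r-prime p-prime r∣p)
... | inj₂ r∣q = inj₂ (prime∣prime⇒≡ r-prime q-prime r∣q)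

large∣⇒prime∣ : ∀ {p m n} .{{_ : NonZero m}} → Prime p → n ℕD.∣ p * m → m < n → p ℕD.∣ n
large∣⇒prime∣ {p} {m} {n} p-prime n∣pm m<n with p ℕD.∣? n
... | yes p∣n = p∣n
... | no p∤n = ⊥-elim (ℕP.<⇒≱ m<n (ℕD.∣⇒≤ (ℕC.coprime-divisor (ℕC.sym (prime∤⇒coprime p-prime p∤n)) n∣pm)))

∣-bound : ∀ {d m} .{{_ : NonZero m}} → d ℤS.∣ + m → ℤ.∣ d ∣ ℕ.≤ m
∣-bound d∣m = ℕD.∣⇒≤ (ℤS.∣⇒∣ᵤ d∣m)

window : ∀ e n .{{_ : NonZero n}} → ℤ.∣ e ∣ ℕ.≤ n → e ≢ ℤ.- + n →
         Σ ℕ λ s → + s ≡ e ℤ.+ + n × 0 < s × s ℕ.≤ n + n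
window (+ m) n m≤n _ =
  m + n , ℤP.pos-+ m n , ℕP.<-≤-trans (ℕ.>-nonZero⁻¹ n) (ℕP.m≤n+m n m) , ℕP.+-monoˡ-≤ n m≤n
window -[1+ m ] n m<n e≢-n =
  n ∸ suc m , sym (ℤP.⊖-≥ m<n) , ℕP.m<n⇒0<n∸m m<n′ , ℕP.≤-trans (ℕP.m∸n≤m n (suc m)) (ℕP.m≤m+n n n)
  where
  m<n′ : suc m < n
  m<n′ = ℕP.≤∧≢⇒< m<n (λ 1+m≡n → e≢-n (cong (λ k → ℤ.- + k) 1+m≡n))

-- If Y < m and Y divides n·m (n > 0), then (1 + n)·Y ≤ n·m: writing m = Y + d with
-- d > 0, Y divides the nonzero number n·d, so Y ≤ n·d.
small-divisor : ∀ n m Y .{{_ : NonZero n}} → Y < m → Y ℕD.∣ n * m → suc n * Y ℕ.≤ n * m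
small-divisor n m Y Y<m Y∣nm with ℕP.m≤n⇒∃[o]m+o≡n Y<m
... | d , refl = subst (suc n * Y ℕ.≤_) (sym (trans (split n d Y) (ℕP.+-comm (n * Y) _))) (ℕP.+-monoˡ-≤ (n * Y) Y≤nd)
  where
  split : ∀ n d Y → n * (suc Y + d) ≡ n * Y + n * suc d
  split = ℕSolver.solve-∀
  Y≤nd : Y ℕ.≤ n * suc d
  Y≤nd = ℕD.∣⇒≤ {{ℕP.m*n≢0 n (suc d)}} (ℕD.∣m+n∣m⇒∣n (subst (Y ℕD.∣_) (split n d Y) Y∣nm) (ℕD.n∣m*n n))

module PrimePair (p₁ q₁ : ℕ) (p-prime : Prime (suc p₁)) (q-prime : Prime (suc q₁)) (p<q : suc p₁ < suc q₁) where

  p q N : ℕ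
  p = suc p₁
  q = suc q₁
  N = p * q

  P Q : ℤ
  P = + p
  Q = + q

  instance
    p₁-nonZero : NonZero p₁
    p₁-nonZero = ℕ.≢-nonZero (λ p₁≡0 → ¬prime[1] (subst (λ n → Prime (suc n)) p₁≡0 p-prime))
    q₁-nonZero : NonZero q₁
    q₁-nonZero = ℕ.≢-nonZero (λ q₁≡0 → ¬prime[1] (subst (λ n → Prime (suc n)) q₁≡0 q-prime))

  φ : ℕ
  φ = p₁ * q₁

  instance
    φ-nonZero : NonZero φ
    φ-nonZero = ℕP.m*n≢0 p₁ q₁
    φ+s-nonZero : ∀ {s} → NonZero (φ + s)
    φ+s-nonZero {s} = ℕ.>-nonZero (ℕP.<-≤-trans (ℕ.>-nonZero⁻¹ φ) (ℕP.m≤m+n φ s))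

  N≡PQ : + N ≡ P ℤ.* Q
  N≡PQ = ℤP.pos-* p q

  korselt-base : ∀ {A : ℚ → Set} {α} → A α → α ≢ 0ℚ → α ≢ ℕ→ℚ N →
                 KorseltAt α N p → KorseltAt α N q → InKS A N α
  korselt-base {α = α} A-α α≢0 α≢N at-p at-q = A-α , α≢0 , α≢N , 2≤N , α≢N , at-every
    where
    2≤N : 2 ℕ.≤ N
    2≤N = ℕP.≤-trans (ℕ.nonTrivial⇒n>1 p {{prime⇒nonTrivial p-prime}}) (ℕP.m≤m*n p q)
    at-every : ∀ r → Prime r → r ℕD.∣ N → KorseltAt α N r
    at-every r r-prime r∣N with prime∣pq r-prime p-prime q-prime r∣N
    ... | inj₁ refl = at-p
    ... | inj₂ refl = at-q

  -- The Korselt conditions of an integral base B at p and at q, in the equivalent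
  -- form (p - B) ∣ p(q - 1) and (q - B) ∣ q(p - 1).
  IntegerKorselt : ℤ → Set
  IntegerKorselt B = (P ℤ.- B) ℤS.∣ P ℤ.* + q₁ × (Q ℤ.- B) ℤS.∣ Q ℤ.* + p₁

  N-B-at-p : ∀ B → + N ℤ.- B ≡ (P ℤ.- B) ℤ.+ P ℤ.* + q₁
  N-B-at-p B = trans (cong (ℤ._- B) N≡PQ) (identity (+ p₁) (+ q₁) B)
    where
    identity : ∀ a b B → (1ℤ ℤ.+ a) ℤ.* (1ℤ ℤ.+ b) ℤ.- B ≡ ((1ℤ ℤ.+ a) ℤ.- B) ℤ.+ (1ℤ ℤ.+ a) ℤ.* b
    identity = solve-∀

  N-B-at-q : ∀ B → + N ℤ.- B ≡ (Q ℤ.- B) ℤ.+ Q ℤ.* + p₁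
  N-B-at-q B = trans (cong (ℤ._- B) N≡PQ) (identity (+ p₁) (+ q₁) B)
    where
    identity : ∀ a b B → (1ℤ ℤ.+ a) ℤ.* (1ℤ ℤ.+ b) ℤ.- B ≡ ((1ℤ ℤ.+ b) ℤ.- B) ℤ.+ (1ℤ ℤ.+ b) ℤ.* a
    identity = solve-∀

  korselt⇒integerKorselt : ∀ β → IsInteger β → KorseltAt β N p → KorseltAt β N q → IntegerKorselt (↥ β)
  korselt⇒integerKorselt β β-int at-p at-q =
    ℤS.∣m+n∣m⇒∣n (subst ((P ℤ.- ↥ β) ℤS.∣_) (N-B-at-p (↥ β)) (integral-korselt β N p β-int at-p)) ℤS.∣-refl ,
    ℤS.∣m+n∣m⇒∣n (subst ((Q ℤ.- ↥ β) ℤS.∣_) (N-B-at-q (↥ β)) (integral-korselt β N q β-int at-q)) ℤS.∣-refl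

  sum≡ : + (q₁ + p) ≡ Q ℤ.+ + p₁
  sum≡ = trans (cong +_ (ℕP.+-suc q₁ p₁)) (ℤP.pos-+ q p₁)

  -- The base p + q - 1 (written q₁ + p) is an integral Korselt base of N, since
  -- N - (p + q - 1) = (p - 1)(q - 1) is a multiple of both p - (p + q - 1) = -(q - 1)
  -- and q - (p + q - 1) = -(p - 1).
  sum-base : InKS IsInteger N (ℕ→ℚ (q₁ + p))
  sum-base = korselt-base {IsInteger} (ℤP.+-injective (↧[i/1] S)) S≢0 S≢N (korselt-/1 S N p at-p) (korselt-/1 S N q at-q)
    where
    S : ℤ
    S = + (q₁ + p)
    N-S≡-at-p : ∀ a b → (1ℤ ℤ.+ a) ℤ.* (1ℤ ℤ.+ b) ℤ.- ((1ℤ ℤ.+ b) ℤ.+ a)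
                        ≡ (ℤ.- a) ℤ.* ((1ℤ ℤ.+ a) ℤ.- ((1ℤ ℤ.+ b) ℤ.+ a))
    N-S≡-at-p = solve-∀
    N-S≡-at-q : ∀ a b → (1ℤ ℤ.+ a) ℤ.* (1ℤ ℤ.+ b) ℤ.- ((1ℤ ℤ.+ b) ℤ.+ a)
                        ≡ (ℤ.- b) ℤ.* ((1ℤ ℤ.+ b) ℤ.- ((1ℤ ℤ.+ b) ℤ.+ a))
    N-S≡-at-q = solve-∀
    at-p : (P ℤ.- S) ℤS.∣ (+ N ℤ.- S)
    at-p = subst (λ s → (P ℤ.- s) ℤS.∣ (+ N ℤ.- s)) (sym sum≡)
             (ℤS.divides (ℤ.- + p₁) (trans (cong (ℤ._- (Q ℤ.+ + p₁)) N≡PQ) (N-S≡-at-p (+ p₁) (+ q₁))))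
    at-q : (Q ℤ.- S) ℤS.∣ (+ N ℤ.- S)
    at-q = subst (λ s → (Q ℤ.- s) ℤS.∣ (+ N ℤ.- s)) (sym sum≡)
             (ℤS.divides (ℤ.- + q₁) (trans (cong (ℤ._- (Q ℤ.+ + p₁)) N≡PQ) (N-S≡-at-q (+ p₁) (+ q₁))))
    S≢0 : ℕ→ℚ (q₁ + p) ≢ 0ℚ
    S≢0 eq = ℕP.m+1+n≢0 q₁ (ℕ→ℚ-injective eq)
    S<N : q₁ + p < N
    S<N = subst (q₁ + p <_) (sym (N≡ p₁ q₁)) (ℕP.m<m+n (q₁ + p) (ℕ.>-nonZero⁻¹ φ))
      where
      N≡ : ∀ a b → suc a * suc b ≡ (b + suc a) + a * b
      N≡ = ℕSolver.solve-∀
    S≢N : ℕ→ℚ (q₁ + p) ≢ ℕ→ℚ N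
    S≢N eq = ℕP.<⇒≢ S<N (ℕ→ℚ-injective eq)

  p⊥q : ℕC.Coprime p q
  p⊥q = prime∤⇒coprime p-prime (λ p∣q → ℕP.<⇒≢ p<q (prime∣prime⇒≡ p-prime q-prime p∣q))

  p∣jq⇒p∣j : ∀ j → p ℕD.∣ j * q → p ℕD.∣ j
  p∣jq⇒p∣j j p∣jq = ℕC.coprime-divisor p⊥q (subst (p ℕD.∣_) (ℕP.*-comm j q) p∣jq)

  p≤multiple : ∀ k → p ℕ.≤ suc k * q
  p≤multiple k = ℕP.≤-trans (ℕP.<⇒≤ p<q) (ℕP.m≤m+n q (k * q))

  abs-divisor : ∀ d → d ℤS.∣ P ℤ.* + q₁ → ℤ.∣ d ∣ ℕD.∣ p * q₁
  abs-divisor d d∣ = subst (ℤ.∣ d ∣ ℕD.∣_) (ℤP.abs-* P (+ q₁)) (ℤS.∣⇒∣ᵤ d∣)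

  -- A multiplier t = 2 + k compatible with the Korselt conditions equals p:
  -- here |p - tq| = tq - p ≥ q is a multiple of p, so p ∣ t; as |1 - t| ≤ p - 1, t = p.
  large-multiplier : ∀ k → suc k ℕ.≤ p₁ → (suc (suc k) * q ∸ p) ℕD.∣ p * q₁ → suc (suc k) ≡ p
  large-multiplier k k<p₁ n∣ = ℕP.≤-antisym (ℕ.s≤s k<p₁) (ℕD.∣⇒≤ (p∣jq⇒p∣j (suc (suc k)) p∣tq))
    where
    q≤n : q ℕ.≤ suc (suc k) * q ∸ p
    q≤n = subst (q ℕ.≤_) (sym (ℕP.+-∸-assoc q (p≤multiple k))) (ℕP.m≤m+n q _)
    p∣tq : p ℕD.∣ suc (suc k) * q
    p∣tq = ℕD.∣m∸n∣n⇒∣m p (p≤multiple (suc k)) (large∣⇒prime∣ p-prime n∣ q≤n) ℕD.∣-refl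

  -- A negative multiplier t = -(1 + k) is incompatible with the Korselt conditions:
  -- |p - tq| = p + (1 + k)q ≥ q would be a multiple of p, forcing
  -- p ≤ 1 + k, while |1 - t| = 2 + k ≤ p - 1.
  negative-multiplier : ∀ k → suc (suc k) ℕ.≤ p₁ → (p + suc k * q) ℕD.∣ p * q₁ → ⊥
  negative-multiplier k k<p₁ n∣ = ℕP.<⇒≱ (ℕP.m≤n⇒m≤1+n k<p₁) (ℕD.∣⇒≤ (p∣jq⇒p∣j (suc k) p∣kq))
    where
    q≤n : q ℕ.≤ p + suc k * q
    q≤n = ℕP.≤-trans (ℕP.m≤m+n q (k * q)) (ℕP.m≤n+m _ p)
    p∣kq : p ℕD.∣ suc k * q
    p∣kq = ℕD.∣m+n∣m⇒∣n (large∣⇒prime∣ p-prime n∣ q≤n) ℕD.∣-refl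

  multiplier : ∀ t → (1ℤ ℤ.- t) ℤS.∣ + p₁ → (P ℤ.- t ℤ.* Q) ℤS.∣ P ℤ.* + q₁ → t ≡ 0ℤ ⊎ t ≡ P
  multiplier (+ zero) _ _ = inj₁ refl
  multiplier (+ suc zero) 0∣p₁ _ = ⊥-elim (ℕ.≢-nonZero⁻¹ p₁ (ℤP.+-injective (ℤS.0∣⇒≡0 0∣p₁)))
  multiplier (+ suc (suc k)) t-1∣ d∣ =
    inj₂ (cong +_ (large-multiplier k (∣-bound t-1∣) (subst (ℕD._∣ p * q₁) ∣p-tq∣ (abs-divisor _ d∣))))
    where
    open ≡-Reasoning
    ∣p-tq∣ : ℤ.∣ P ℤ.- + suc (suc k) ℤ.* Q ∣ ≡ suc (suc k) * q ∸ p
    ∣p-tq∣ = begin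
      ℤ.∣ P ℤ.- + suc (suc k) ℤ.* Q ∣     ≡⟨ cong (λ x → ℤ.∣ P ℤ.- x ∣) (sym (ℤP.pos-* (suc (suc k)) q)) ⟩
      ℤ.∣ P ℤ.- + (suc (suc k) * q) ∣     ≡⟨ cong ℤ.∣_∣ (ℤP.[+m]-[+n]≡m⊖n p (suc (suc k) * q)) ⟩
      ℤ.∣ p ℤ.⊖ suc (suc k) * q ∣         ≡⟨ ℤP.∣⊖∣-≤ (p≤multiple (suc k)) ⟩
      suc (suc k) * q ∸ p                 ∎
  multiplier -[1+ k ] t-1∣ d∣ =
    ⊥-elim (negative-multiplier k (∣-bound t-1∣) (subst (ℕD._∣ p * q₁) ∣p-tq∣ (abs-divisor _ d∣)))
    where
    expand : ∀ P K Q → P ℤ.- (ℤ.- K) ℤ.* Q ≡ P ℤ.+ K ℤ.* Q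
    expand = solve-∀
    ∣p-tq∣ : ℤ.∣ P ℤ.- -[1+ k ] ℤ.* Q ∣ ≡ p + suc k * q
    ∣p-tq∣ = cong ℤ.∣_∣ (trans (expand P (+ suc k) Q)
                                (trans (cong (λ x → P ℤ.+ x) (sym (ℤP.pos-* (suc k) q))) (sym (ℤP.pos-+ p (suc k * q)))))

  cancel-q : ∀ t → (Q ℤ.- t ℤ.* Q) ℤS.∣ Q ℤ.* + p₁ → (1ℤ ℤ.- t) ℤS.∣ + p₁
  cancel-q t = ℤS.*-cancelʳ-∣ Q {1ℤ ℤ.- t} {+ p₁} ∘ subst₂ ℤS._∣_ (factor t Q) (ℤP.*-comm Q (+ p₁))
    where
    factor : ∀ t Q → Q ℤ.- t ℤ.* Q ≡ (1ℤ ℤ.- t) ℤ.* Q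
    factor = solve-∀

  q∣base⇒trivial : ∀ {B} → IntegerKorselt B → Q ℤS.∣ B → B ≡ 0ℤ ⊎ B ≡ + N
  q∣base⇒trivial (at-p , at-q) (ℤS.divides t refl) with multiplier t (cancel-q t at-q) at-p
  ... | inj₁ refl = inj₁ (ℤP.*-zeroˡ Q)
  ... | inj₂ refl = inj₂ (sym N≡PQ)

  q∤q-B : ∀ {B} → IntegerKorselt B → B ≢ 0ℤ → B ≢ + N → ¬ (Q ℤS.∣ Q ℤ.- B)
  q∤q-B {B} korselt B≢0 B≢N q∣q-B = [ B≢0 , B≢N ] (q∣base⇒trivial korselt q∣B)
    where
    Q-[Q-B]≡B : ∀ Q B → Q ℤ.- (Q ℤ.- B) ≡ B
    Q-[Q-B]≡B = solve-∀
    q∣B : Q ℤS.∣ B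
    q∣B = subst (Q ℤS.∣_) (Q-[Q-B]≡B Q B) (ℤS.∣m∣n⇒∣m-n ℤS.∣-refl q∣q-B)

  -- Being prime to q, the divisor q - B of q(p - 1) divides p - 1, so |q - B| ≤ p - 1.
  ∣q-B∣≤p₁ : ∀ {B} → (Q ℤ.- B) ℤS.∣ Q ℤ.* + p₁ → ¬ (Q ℤS.∣ Q ℤ.- B) → ℤ.∣ Q ℤ.- B ∣ ℕ.≤ p₁
  ∣q-B∣≤p₁ {B} q-B∣ q∤q-B = ℕD.∣⇒≤ (ℤC.coprime-divisor (Q ℤ.- B) Q (+ p₁) coprime (ℤS.∣⇒∣ᵤ q-B∣))
    where
    coprime : ℤC.Coprime (Q ℤ.- B) Q
    coprime = ℕC.sym (prime∤⇒coprime q-prime (q∤q-B ∘ ℤS.∣ᵤ⇒∣))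

  -- If φ + s ∣ N·s then also φ + s ∣ N·φ = N·(φ + s) - N·s; dropping the prime q,
  -- which does not divide φ + s, leaves φ + s ∣ p·φ.
  divides-pφ : ∀ s → ¬ (q ℕD.∣ φ + s) → (φ + s) ℕD.∣ N * s → (φ + s) ℕD.∣ p * φ
  divides-pφ s q∤X X∣Ns = ℕC.coprime-divisor (ℕC.sym (prime∤⇒coprime q-prime q∤X)) X∣qpφ
    where
    regroup : ∀ p q φ s → p * q * (φ + s) ≡ p * q * s + q * (p * φ)
    regroup = ℕSolver.solve-∀
    X∣qpφ : (φ + s) ℕD.∣ q * (p * φ)
    X∣qpφ = ℕD.∣m+n∣m⇒∣n (subst ((φ + s) ℕD.∣_) (regroup p q φ s) (ℕD.n∣m*n N)) X∣Ns

  -- Step 3: for 0 < s ≤ 2(p - 1) with s ≠ q - 1 and q ∤ φ + s, the number φ + s does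
  -- not divide N·s. Otherwise φ + s ∣ p·φ; if p ∤ φ + s this gives φ + s ≤ φ, and if
  -- φ + s = p·Y then Y ∣ φ = (p - 1)(q - 1) with Y < q - 1, so p·Y ≤ φ by small-divisor.
  non-integral : ∀ s → 0 < s → s ℕ.≤ p₁ + p₁ → s ≢ q₁ → ¬ (q ℕD.∣ φ + s) → ¬ ((φ + s) ℕD.∣ N * s)
  non-integral s 0<s s≤2p₁ s≢q₁ q∤X X∣Ns = by-cases (p ℕD.∣? (φ + s))
    where
    φ<X : φ < φ + s
    φ<X = ℕP.m<m+n φ 0<s
    X∣pφ : (φ + s) ℕD.∣ p * φ
    X∣pφ = divides-pφ s q∤X X∣Ns
    X<N : φ + s < q * p
    X<N = subst (φ + s <_) (N≡ p₁ q₁)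
                (ℕ.s≤s (ℕP.+-monoʳ-≤ φ (ℕP.≤-trans s≤2p₁ (ℕP.+-monoʳ-≤ p₁ (ℕP.<⇒≤ (ℕP.≤-pred p<q))))))
      where
      N≡ : ∀ a b → suc (a * b + (a + b)) ≡ suc b * suc a
      N≡ = ℕSolver.solve-∀
    by-cases : Dec (p ℕD.∣ φ + s) → ⊥
    by-cases (no p∤X) =
      ℕP.<⇒≱ φ<X (ℕD.∣⇒≤ (ℕC.coprime-divisor (ℕC.sym (prime∤⇒coprime p-prime p∤X)) X∣pφ))
    by-cases (yes (ℕD.divides Y X≡Yp)) = ℕP.<⇒≱ φ<X (subst (ℕ._≤ φ) pY≡X (small-divisor p₁ q₁ Y Y<q₁ Y∣φ))
      where
      pY≡X : p * Y ≡ φ + s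
      pY≡X = trans (ℕP.*-comm p Y) (sym X≡Yp)
      Y∣φ : Y ℕD.∣ φ
      Y∣φ = ℕD.*-cancelˡ-∣ p (subst (ℕD._∣ p * φ) (sym pY≡X) X∣pφ)
      Y≢q₁ : Y ≢ q₁
      Y≢q₁ refl = s≢q₁ (ℕP.+-cancelˡ-≡ φ s q₁ (trans X≡Yp (q₁p≡ p₁ q₁)))
        where
        q₁p≡ : ∀ a b → b * suc a ≡ a * b + b
        q₁p≡ = ℕSolver.solve-∀
      Y<q₁ : Y < q₁
      Y<q₁ = ℕP.≤∧≢⇒< (ℕP.≤-pred (ℕP.*-cancelʳ-< p Y q (subst (_< q * p) X≡Yp X<N))) Y≢q₁

  scaled-base : ℕ → ℚ
  scaled-base s = + (N * s) / (φ + s)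

  -- Step 4: if B = p + q - 1 - s is an integral Korselt base with s > 0, then the
  -- Korselt conditions hold for N·s/(φ + s), because
  --   (φ + s)·p - N·s = -p(q - 1)·(q - B),   (φ + s)·q - N·s = -q(p - 1)·(p - B),
  --   (φ + s)·N - N·s = p(q - 1)·q(p - 1).
  rational-base : ∀ s → 0 < s → IntegerKorselt (Q ℤ.+ + p₁ ℤ.- + s) → ¬ ((φ + s) ℕD.∣ N * s) →
                  InKS NonInteger N (scaled-base s)
  rational-base s 0<s (at-p , at-q) X∤Ns =
    korselt-base {NonInteger} α-nonint α≢0 (nonInteger⇒≢ℕ N α-nonint)
                 (korselt-/ A X N p scaled-at-p) (korselt-/ A X N q scaled-at-q)
    where
    X : ℕ
    X = φ + s
    A : ℤ
    A = + (N * s)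
    α-nonint : NonInteger (scaled-base s)
    α-nonint int = X∤Ns (ℤS.∣⇒∣ᵤ (integral-/ A X int))
    α≢0 : scaled-base s ≢ 0ℚ
    α≢0 = /-≢0 A X (ℕ.≢-nonZero⁻¹ (N * s) {{Ns-nonZero}} ∘ ℤP.+-injective)
      where
      Ns-nonZero : NonZero (N * s)
      Ns-nonZero = ℕP.m*n≢0 N s {{ℕP.m*n≢0 p q}} {{ℕ.>-nonZero 0<s}}
    expand : ∀ R → + X ℤ.* R ℤ.- A ≡ (+ p₁ ℤ.* + q₁ ℤ.+ + s) ℤ.* R ℤ.- P ℤ.* Q ℤ.* + s
    expand R = cong₂ (λ x a → x ℤ.* R ℤ.- a) (trans (ℤP.pos-+ φ s) (cong (ℤ._+ + s) (ℤP.pos-* p₁ q₁)))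
                                            (trans (ℤP.pos-* N s) (cong (ℤ._* + s) N≡PQ))
    expand-N : + X ℤ.* + N ℤ.- A ≡ (+ p₁ ℤ.* + q₁ ℤ.+ + s) ℤ.* (P ℤ.* Q) ℤ.- P ℤ.* Q ℤ.* + s
    expand-N = trans (cong (λ n → + X ℤ.* n ℤ.- A) N≡PQ) (expand (P ℤ.* Q))
    at-N : ∀ a b s → (a ℤ.* b ℤ.+ s) ℤ.* ((1ℤ ℤ.+ a) ℤ.* (1ℤ ℤ.+ b)) ℤ.- (1ℤ ℤ.+ a) ℤ.* (1ℤ ℤ.+ b) ℤ.* s
                     ≡ (ℤ.- ((1ℤ ℤ.+ a) ℤ.* b)) ℤ.* (ℤ.- ((1ℤ ℤ.+ b) ℤ.* a))
    at-N = solve-∀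
    scaled-at-p : (+ X ℤ.* P ℤ.- A) ℤS.∣ (+ X ℤ.* + N ℤ.- A)
    scaled-at-p = subst₂ ℤS._∣_ (sym (trans (expand P) (identity (+ p₁) (+ q₁) (+ s))))
                                (sym (trans expand-N (at-N (+ p₁) (+ q₁) (+ s))))
                                (ℤS.*-monoʳ-∣ (ℤ.- (P ℤ.* + q₁)) (ℤS.∣m⇒∣-m at-q))
      where
      identity : ∀ a b s → (a ℤ.* b ℤ.+ s) ℤ.* (1ℤ ℤ.+ a) ℤ.- (1ℤ ℤ.+ a) ℤ.* (1ℤ ℤ.+ b) ℤ.* s
                           ≡ (ℤ.- ((1ℤ ℤ.+ a) ℤ.* b)) ℤ.* ((1ℤ ℤ.+ b) ℤ.- ((1ℤ ℤ.+ b) ℤ.+ a ℤ.- s))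
      identity = solve-∀
    scaled-at-q : (+ X ℤ.* Q ℤ.- A) ℤS.∣ (+ X ℤ.* + N ℤ.- A)
    scaled-at-q = subst₂ ℤS._∣_ (sym (trans (expand Q) (identity (+ p₁) (+ q₁) (+ s))))
                                (sym (trans expand-N (trans (at-N (+ p₁) (+ q₁) (+ s)) (ℤP.*-comm k (ℤ.- (Q ℤ.* + p₁))))))
                                (ℤS.*-monoʳ-∣ (ℤ.- (Q ℤ.* + p₁)) (ℤS.∣m⇒∣-m at-p))
      where
      k : ℤ
      k = ℤ.- (P ℤ.* + q₁)
      identity : ∀ a b s → (a ℤ.* b ℤ.+ s) ℤ.* (1ℤ ℤ.+ b) ℤ.- (1ℤ ℤ.+ a) ℤ.* (1ℤ ℤ.+ b) ℤ.* s
                           ≡ (ℤ.- ((1ℤ ℤ.+ b) ℤ.* a)) ℤ.* ((1ℤ ℤ.+ a) ℤ.- ((1ℤ ℤ.+ b) ℤ.+ a ℤ.- s))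
      identity = solve-∀

  offset-base : ∀ s → 0 < s → s ℕ.≤ p₁ + p₁ → IntegerKorselt (Q ℤ.+ + p₁ ℤ.- + s) →
                ¬ (Q ℤS.∣ + s ℤ.- + p₁) → Σ ℚ (InKS NonInteger N)
  offset-base s 0<s s≤2p₁ korselt@(at-p , _) q∤s-p₁ =
    scaled-base s , rational-base s 0<s korselt (non-integral s 0<s s≤2p₁ s≢q₁ q∤X)
    where
    -- For s = q - 1 the base would be B = p, and 0 ∤ p(q - 1).
    s≢q₁ : s ≢ q₁
    s≢q₁ refl = ℕ.≢-nonZero⁻¹ (p * q₁) {{ℕP.m*n≢0 p q₁}} (ℤP.+-injective (trans (ℤP.pos-* p q₁) pq₁≡0))
      where
      vanish : ∀ a b → (1ℤ ℤ.+ a) ℤ.- ((1ℤ ℤ.+ b) ℤ.+ a ℤ.- b) ≡ 0ℤ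
      vanish = solve-∀
      pq₁≡0 : P ℤ.* + q₁ ≡ 0ℤ
      pq₁≡0 = ℤS.0∣⇒≡0 (subst (ℤS._∣ P ℤ.* + q₁) (vanish (+ p₁) (+ q₁)) at-p)
    -- φ + s = q(p - 1) + (s - (p - 1)), so q ∣ φ + s would give q ∣ s - (p - 1).
    q∤X : ¬ (q ℕD.∣ φ + s)
    q∤X q∣X = q∤s-p₁ (ℤS.∣m+n∣m⇒∣n (subst (Q ℤS.∣_) X≡ (ℤS.∣ᵤ⇒∣ {Q} {+ (φ + s)} q∣X)) (ℤS.∣m⇒∣m*n (+ p₁) ℤS.∣-refl))
      where
      split : ∀ a b s → a ℤ.* b ℤ.+ s ≡ (1ℤ ℤ.+ b) ℤ.* a ℤ.+ (s ℤ.- a)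
      split = solve-∀
      X≡ : + (φ + s) ≡ Q ℤ.* + p₁ ℤ.+ (+ s ℤ.- + p₁)
      X≡ = trans (ℤP.pos-+ φ s) (trans (cong (ℤ._+ + s) (ℤP.pos-* p₁ q₁)) (split (+ p₁) (+ q₁) (+ s)))

  -- Every integral Korselt base B ∉ {0, N, p + q - 1} yields a non-integral one: with
  -- q - B ∣ p - 1 and B ≠ p + q - 1 the offset s = (q - B) + (p - 1) satisfies 0 < s ≤ 2(p - 1).
  non-integral-base : ∀ {B} → IntegerKorselt B → B ≢ 0ℤ → B ≢ + N → B ≢ + (q₁ + p) → Σ ℚ (InKS NonInteger N)
  non-integral-base {B} korselt@(_ , at-q) B≢0 B≢N B≢sum =
    from-offset (window (Q ℤ.- B) p₁ (∣q-B∣≤p₁ {B} at-q q∤e) q-B≢-p₁)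
    where
    q∤e : ¬ (Q ℤS.∣ Q ℤ.- B)
    q∤e = q∤q-B korselt B≢0 B≢N
    B≡Q-[Q-B] : ∀ B Q → B ≡ Q ℤ.- (Q ℤ.- B)
    B≡Q-[Q-B] = solve-∀
    Q-[-a]≡Q+a : ∀ Q a → Q ℤ.- (ℤ.- a) ≡ Q ℤ.+ a
    Q-[-a]≡Q+a = solve-∀
    q-B≢-p₁ : Q ℤ.- B ≢ ℤ.- + p₁
    q-B≢-p₁ q-B≡-p₁ = B≢sum (begin
      B                     ≡⟨ B≡Q-[Q-B] B Q ⟩
      Q ℤ.- (Q ℤ.- B)       ≡⟨ cong (λ x → Q ℤ.- x) q-B≡-p₁ ⟩
      Q ℤ.- (ℤ.- + p₁)      ≡⟨ Q-[-a]≡Q+a Q (+ p₁) ⟩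
      Q ℤ.+ + p₁            ≡⟨ sym sum≡ ⟩
      + (q₁ + p)            ∎)
      where open ≡-Reasoning
    from-offset : (Σ ℕ λ s → + s ≡ (Q ℤ.- B) ℤ.+ + p₁ × 0 < s × s ℕ.≤ p₁ + p₁) → Σ ℚ (InKS NonInteger N)
    from-offset (s , s≡ , 0<s , s≤2p₁) =
      offset-base s 0<s s≤2p₁ (subst IntegerKorselt B≡ korselt) (subst (λ x → ¬ (Q ℤS.∣ x)) s-p₁≡ q∤e)
      where
      recover-B : ∀ B Q a → B ≡ Q ℤ.+ a ℤ.- ((Q ℤ.- B) ℤ.+ a)
      recover-B = solve-∀
      recover-q-B : ∀ B Q a → (Q ℤ.- B) ℤ.+ a ℤ.- a ≡ Q ℤ.- B
      recover-q-B = solve-∀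
      B≡ : B ≡ Q ℤ.+ + p₁ ℤ.- + s
      B≡ = trans (recover-B B Q (+ p₁)) (cong (λ x → Q ℤ.+ + p₁ ℤ.- x) (sym s≡))
      s-p₁≡ : Q ℤ.- B ≡ + s ℤ.- + p₁
      s-p₁≡ = sym (trans (cong (ℤ._- + p₁) s≡) (recover-q-B B Q (+ p₁)))

  only-sum-base : (∀ β → ¬ InKS NonInteger N β) → ∀ β → InKS IsInteger N β → β ≡ ℕ→ℚ (q₁ + p)
  only-sum-base none β (β-int , β≢0 , β≢N , _ , _ , korselt) with ↥ β ℤP.≟ + (q₁ + p)
  ... | yes B≡sum = integral⇒≡ (+ (q₁ + p)) β-int B≡sum
  ... | no B≢sum = ⊥-elim (uncurry none (non-integral-base integer-korselt B≢0 B≢N B≢sum))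
    where
    B≢0 : ↥ β ≢ 0ℤ
    B≢0 = β≢0 ∘ ℚP.↥p≡0⇒p≡0 β
    B≢N : ↥ β ≢ + N
    B≢N = β≢N ∘ integral⇒≡ (+ N) β-int
    integer-korselt : IntegerKorselt (↥ β)
    integer-korselt = korselt⇒integerKorselt β β-int (korselt p p-prime (ℕD.m∣m*n q)) (korselt q q-prime (ℕD.n∣m*n p))

mainTheorem1 : (p q : ℕ) → Prime p → Prime q → p < q →
    (∀ (β : ℚ) → ¬ InKS NonInteger (p * q) β) →
    ∀ (β : ℚ) → InKS IsInteger (p * q) β ⇔ (β ≡ ℕ→ℚ (q + p ∸ 1))
mainTheorem1 zero _ p-prime = ⊥-elim (¬prime[0] p-prime)
mainTheorem1 (suc p₁) zero _ q-prime = ⊥-elim (¬prime[0] q-prime)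
mainTheorem1 (suc p₁) (suc q₁) p-prime q-prime p<q none β =
  mk⇔ (only-sum-base none β) (λ { refl → sum-base })
  where open PrimePair p₁ q₁ p-prime q-prime p<q
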